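{- Let $k>0$ be an integer and let $G$ be a finite, connected, simple graph. Then $\beta_k(G)=1$ if and only if $G$ is isomorphic to the path $P_n$ on $n$ vertices for some $n\le k+2$.
   Context: For a graph $G=(V,E)$ with geodesic (shortest-path) distance $d$, and an integer $k\ge 0$, define $d_k(u,v):=\min\{d(u,v),k+1\}$. A non-empty set $R\subseteq V$ is a $k$-truncated resolving set of $G$ if for all $u,v\in V$, $d_k(u,r)=d_k(v,r)$ for every $r\in R$ implies $u=v$. The $k$-truncated metric dimension $\beta_k(G)$ is the minimum size of a $k$-truncated resolving set of $G$. -}

module Defs where

open import Data.Nat using (ℕ; zero; suc; _≤_; _⊓_)
open import Data.Nat.Properties using (1+n≢n)
open import Data.Fin using (Fin; toℕ)
open import Data.Fin.Subset using (Subset; _∈_; ∣_∣; Nonempty)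
open import Data.Product using (Σ; _×_; ∃; ∃-syntax)
open import Data.Sum using (_⊎_; inj₁; inj₂)
open import Data.Empty using (⊥)
open import Relation.Binary.PropositionalEquality using (_≡_)
open import Function.Bundles using (Bijection; _⤖_; _⇔_)

record Graph (n : ℕ) : Set₁ where
  field
    Adj   : Fin n → Fin n → Set
    symm  : ∀ {u v} → Adj u v → Adj v u
    irrefl : ∀ {u} → Adj u u → ⊥
open Graph public

data Walk {n : ℕ} (G : Graph n) : Fin n → Fin n → ℕ → Set where
  here : ∀ {u} → Walk G u u 0
  step : ∀ {u w v m} → Adj G u w → Walk G w v m → Walk G u v (suc m)

Connected : ∀ {n} → Graph n → Set
Connected G = ∀ u v → ∃[ m ] Walk G u v m

IsDist : ∀ {n} → Graph n → Fin n → Fin n → ℕ → Set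
IsDist G u v d = Walk G u v d × (∀ m → Walk G u v m → d ≤ m)

IsTruncResolving : ∀ {n} → Graph n → ℕ → Subset n → Set
IsTruncResolving {n} G k R =
  Nonempty R ×
  (∀ (u v : Fin n) →
     (∀ r → r ∈ R → ∀ d e → IsDist G u r d → IsDist G v r e →
        d ⊓ suc k ≡ e ⊓ suc k) →
     u ≡ v)

TruncMetricDim : ∀ {n} → Graph n → ℕ → ℕ → Set
TruncMetricDim {n} G k b =
  (Σ (Subset n) λ R → IsTruncResolving G k R × ∣ R ∣ ≡ b) ×
  (∀ (R : Subset n) → IsTruncResolving G k R → b ≤ ∣ R ∣)

PathAdj : ∀ {m} → Fin m → Fin m → Set
PathAdj i j = suc (toℕ i) ≡ toℕ j ⊎ suc (toℕ j) ≡ toℕ i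

pathSym : ∀ {m} {i j : Fin m} → PathAdj i j → PathAdj j i
pathSym (inj₁ p) = inj₂ p
pathSym (inj₂ p) = inj₁ p

pathIrrefl : ∀ {m} {i : Fin m} → PathAdj i i → ⊥
pathIrrefl {i = i} (inj₁ p) = 1+n≢n p
pathIrrefl {i = i} (inj₂ p) = 1+n≢n p

PathGraph : (m : ℕ) → Graph m
PathGraph m = record { Adj = PathAdj ; symm = pathSym ; irrefl = pathIrrefl }

_≅_ : ∀ {n m} → Graph n → Graph m → Set
_≅_ {n} {m} G H =
  Σ (Fin n ⤖ Fin m) λ f →
    ∀ u v → Adj G u v ⇔ Adj H (Bijection.to f u) (Bijection.to f v)

module Submission where

open import Defs
import Data.Nat
open import Data.Nat using (ℕ; zero; suc; _≤_; _<_; _+_; _⊓_; z≤n; s≤s; s≤s⁻¹; _≤?_; _<?_)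
open import Data.Nat.Properties
  using (≤-antisym; ≤-trans; ≤-reflexive; ≤-refl; <⇒≤; <⇒≢; <⇒≱; ≰⇒>; ≮⇒≥; <-cmp; n≤1+n; n<1+n;
         m<1+n⇒m<n∨m≡n; m≤n⇒m<n∨m≡n; m≤n⇒m⊓n≡m; m≥n⇒m⊓n≡n; +-comm; +-identityʳ; 1+n≰n)
open import Data.Product using (_×_; ∃; ∃₂; ∃-syntax; _,_; proj₁; proj₂)
open import Data.Sum using (_⊎_; inj₁; inj₂; [_,_]′)
open import Data.Empty using (⊥)
open import Data.Fin using (Fin; zero; toℕ; fromℕ<; _≟_)
open import Data.Fin.Properties
  using (any?; sequence; toℕ-fromℕ<; toℕ-injective; toℕ<n; injective⇒≤)
open import Data.Fin.Subset using (Subset; _∈_; _⊆_; ∣_∣; ⁅_⁆)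
open import Data.Fin.Subset.Properties
  using (x∈⁅x⁆; x∈⁅y⁆⇒x≡y; x≢y⇒x∉⁅y⁆; ∣⁅x⁆∣≡1; p⊆q⇒∣p∣≤∣q∣; p⊂q⇒∣p∣<∣q∣)
open import Effect.Monad using (RawMonad)
open import Function.Bundles using (_⇔_; mk⇔; mk⤖; Bijection; Surjection; Equivalence)
open import Function.Consequences.Propositional using (strictlySurjective⇒surjective)
open import Relation.Binary using (tri<; tri≈; tri>)
open import Relation.Binary.PropositionalEquality
  using (_≡_; refl; sym; trans; cong; subst; subst₂; module ≡-Reasoning)
open import Relation.Nullary using (Dec; yes; no; ¬_; contradiction)
open import Relation.Nullary.Decidable using (_×-dec_; _⊎-dec_; map′; decidable-stable; ¬¬-excluded-middle)
open import Relation.Nullary.Negation using (¬¬-Monad)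

-- If a single vertex r resolves G, the map u ↦ d(u, r) is injective. Every level
-- 0, …, d(u, r) of a geodesic from u is occupied, so the levels are exactly 0, …, n − 1, and
-- none of them exceeds k + 1 (a vertex beyond level k + 1 would be confused with the vertex at
-- level k + 1 on its geodesic). Edges join consecutive levels, and every vertex of level ℓ + 1
-- has a neighbour of level ℓ, which is then the unique vertex of that level: G is the path
-- 0, 1, …, n − 1 with n ≤ k + 2. Conversely an end vertex of P_m resolves it, since no distance
-- exceeds m − 1 ≤ k + 1 and the truncation never applies.
--
-- Adjacency is an arbitrary relation here, so computing distances first requires deciding it.
-- The edges traversed by the walks witnessing connectivity form a decidable relation, and
-- showing that it contains every edge is a negative goal, for which the decidability of all
-- adjacencies may be assumed classically.

Least : (ℕ → Set) → ℕ → Set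
Least P ℓ = P ℓ × (∀ {j} → j < ℓ → ¬ P j)

module _ {P : ℕ → Set} (P? : ∀ i → Dec (P i)) where

  least-or-none : ∀ m → ∃ (Least P) ⊎ (∀ {j} → j < m → ¬ P j)
  least-or-none zero = inj₂ λ ()
  least-or-none (suc m) with least-or-none m
  ... | inj₁ least = inj₁ least
  ... | inj₂ none with P? m
  ...   | yes pm = inj₁ (m , pm , none)
  ...   | no ¬pm = inj₂ none-below-1+m
    where
    none-below-1+m : ∀ {j} → j < suc m → ¬ P j
    none-below-1+m j<1+m with m<1+n⇒m<n∨m≡n j<1+m
    ... | inj₁ j<m  = none j<m
    ... | inj₂ refl = ¬pm

  least-witness : ∀ {m} → P m → ∃ (Least P)
  least-witness {m} pm with least-or-none (suc m)
  ... | inj₁ least = least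
  ... | inj₂ none  = contradiction pm (none (n<1+n m))

module _ {n} {p : Subset n} {x : Fin n} (x∈p : x ∈ p) where

  x∈p⇒⁅x⁆⊆p : ⁅ x ⁆ ⊆ p
  x∈p⇒⁅x⁆⊆p {y} y∈⁅x⁆ = subst (_∈ p) (sym (x∈⁅y⁆⇒x≡y x y∈⁅x⁆)) x∈p

  x∈p⇒1≤∣p∣ : 1 ≤ ∣ p ∣
  x∈p⇒1≤∣p∣ = subst (_≤ ∣ p ∣) (∣⁅x⁆∣≡1 x) (p⊆q⇒∣p∣≤∣q∣ x∈p⇒⁅x⁆⊆p)

  ∣p∣≡1⇒∈-unique : ∣ p ∣ ≡ 1 → ∀ {y} → y ∈ p → y ≡ x
  ∣p∣≡1⇒∈-unique ∣p∣≡1 {y} y∈p with y ≟ x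
  ... | yes y≡x = y≡x
  ... | no y≢x  = contradiction (sym ∣p∣≡1) (<⇒≢ 1<∣p∣)
    where
    1<∣p∣ : 1 < ∣ p ∣
    1<∣p∣ = subst (_< ∣ p ∣) (∣⁅x⁆∣≡1 x)
      (p⊂q⇒∣p∣<∣q∣ (x∈p⇒⁅x⁆⊆p , y , y∈p , x≢y⇒x∉⁅y⁆ y≢x))

injective-bounded⇒≤ : ∀ {n b} (f : Fin n → ℕ) → (∀ i → f i < b) →
                      (∀ {i j} → f i ≡ f j → i ≡ j) → n ≤ b
injective-bounded⇒≤ {n} {b} f f<b f-injective = injective⇒≤ {f = f′} f′-injective
  where
  f′ : Fin n → Fin b
  f′ i = fromℕ< (f<b i)
  f′-injective : ∀ {i j} → f′ i ≡ f′ j → i ≡ j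
  f′-injective {i} {j} eq = f-injective (begin
    f i       ≡⟨ sym (toℕ-fromℕ< (f<b i)) ⟩
    toℕ (f′ i) ≡⟨ cong toℕ eq ⟩
    toℕ (f′ j) ≡⟨ toℕ-fromℕ< (f<b j) ⟩
    f j       ∎)
    where open ≡-Reasoning

module _ {n} {G : Graph n} where

  Walk-0⇒≡ : ∀ {u v} → Walk G u v 0 → u ≡ v
  Walk-0⇒≡ here = refl

  Walk-uncons : ∀ {u v m} → Walk G u v (suc m) → ∃[ w ] (Adj G u w × Walk G w v m)
  Walk-uncons (step e rest) = _ , e , rest

  Traverses : ∀ {x y m} → Walk G x y m → Fin n → Fin n → Set
  Traverses here                      a b = ⊥
  Traverses (step {u} {w} _ rest) a b = (a ≡ u × b ≡ w) ⊎ Traverses rest a b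

  traverses? : ∀ {x y m} (w : Walk G x y m) a b → Dec (Traverses w a b)
  traverses? here                      a b = no λ ()
  traverses? (step {u} {w} _ rest) a b = ((a ≟ u) ×-dec (b ≟ w)) ⊎-dec traverses? rest a b

  traverses⇒Adj : ∀ {x y m} (w : Walk G x y m) {a b} → Traverses w a b → Adj G a b
  traverses⇒Adj (step e _)    (inj₁ (refl , refl)) = e
  traverses⇒Adj (step _ rest) (inj₂ t)             = traverses⇒Adj rest t

Consecutive : ℕ → ℕ → Set
Consecutive a b = suc a ≡ b ⊎ suc b ≡ a

Consecutive⇒≤1+ : ∀ {a b} → Consecutive a b → a ≤ suc b
Consecutive⇒≤1+ (inj₁ refl) = ≤-trans (n≤1+n _) (n≤1+n _)
Consecutive⇒≤1+ (inj₂ refl) = ≤-refl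

module Geodesics {n} (G : Graph n) (adj? : ∀ u v → Dec (Adj G u v)) (conn : Connected G)
                 (r : Fin n) where

  walk? : ∀ ℓ u → Dec (Walk G u r ℓ)
  walk? zero    u = map′ (λ { refl → here }) Walk-0⇒≡ (u ≟ r)
  walk? (suc ℓ) u = map′ (λ (_ , e , rest) → step e rest) Walk-uncons
                         (any? λ w → adj? u w ×-dec walk? ℓ w)

  geodesic : ∀ u → ∃ (IsDist G u r)
  geodesic u with least-witness (λ ℓ → walk? ℓ u) (proj₂ (conn u r))
  ... | ℓ , walk , shorter = ℓ , walk , λ m walk′ → ≮⇒≥ λ m<ℓ → shorter m<ℓ walk′

  dist : Fin n → ℕ
  dist u = proj₁ (geodesic u)

  dist-walk : ∀ u → Walk G u r (dist u)
  dist-walk u = proj₁ (proj₂ (geodesic u))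

  dist-minimal : ∀ {u m} → Walk G u r m → dist u ≤ m
  dist-minimal {u} = proj₂ (proj₂ (geodesic u)) _

  IsDist⇒≡dist : ∀ {u d} → IsDist G u r d → d ≡ dist u
  IsDist⇒≡dist {u} (walk , minimal) = ≤-antisym (minimal _ (dist-walk u)) (dist-minimal walk)

  dist-r≤ : ∀ {ℓ} → dist r ≤ ℓ
  dist-r≤ = ≤-trans (dist-minimal here) z≤n

  dist-adj-≤ : ∀ {u v} → Adj G u v → dist u ≤ suc (dist v)
  dist-adj-≤ {u} {v} e = dist-minimal (step e (dist-walk v))

  dist-descent : ∀ {u ℓ} → dist u ≡ suc ℓ → ∃[ w ] (Adj G u w × dist w ≡ ℓ)
  dist-descent {u} {ℓ} du≡1+ℓ with Walk-uncons (subst (Walk G u r) du≡1+ℓ (dist-walk u))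
  ... | w , e , rest = w , e , ≤-antisym (dist-minimal rest) (s≤s⁻¹ 1+ℓ≤1+dw)
    where
    1+ℓ≤1+dw : suc ℓ ≤ suc (dist w)
    1+ℓ≤1+dw = subst (_≤ suc (dist w)) du≡1+ℓ (dist-adj-≤ e)

  -- Distances change by at most one along an edge.
  walk-descends : ∀ {x y m} (w : Walk G x y m) {ℓ} → ℓ < dist x → dist y ≤ ℓ →
                  ∃₂ λ p q → Traverses w p q × dist p ≡ suc ℓ × dist q ≡ ℓ
  walk-descends here ℓ<dx dx≤ℓ = contradiction (≤-trans ℓ<dx dx≤ℓ) (1+n≰n)
  walk-descends (step {x} {x′} e rest) {ℓ} ℓ<dx dy≤ℓ with ℓ <? dist x′
  ... | yes ℓ<dx′ with walk-descends rest ℓ<dx′ dy≤ℓ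
  ...   | p , q , t , dp , dq = p , q , inj₂ t , dp , dq
  walk-descends (step {x} {x′} e rest) {ℓ} ℓ<dx dy≤ℓ | no ℓ≮dx′ =
    x , x′ , inj₁ (refl , refl) , sym 1+ℓ≡dx , dx′≡ℓ
    where
    dx′≤ℓ : dist x′ ≤ ℓ
    dx′≤ℓ = s≤s⁻¹ (≰⇒> ℓ≮dx′)
    1+ℓ≡dx : suc ℓ ≡ dist x
    1+ℓ≡dx = ≤-antisym ℓ<dx (≤-trans (dist-adj-≤ e) (s≤s dx′≤ℓ))
    dx′≡ℓ : dist x′ ≡ ℓ
    dx′≡ℓ = ≤-antisym dx′≤ℓ (s≤s⁻¹ (≤-trans ℓ<dx (dist-adj-≤ e)))

  dist-below : ∀ {u ℓ} → ℓ ≤ dist u → ∃[ w ] (dist w ≡ ℓ)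
  dist-below {u} ℓ≤du with m≤n⇒m<n∨m≡n ℓ≤du
  ... | inj₂ refl = u , refl
  ... | inj₁ ℓ<du with walk-descends (dist-walk u) ℓ<du dist-r≤
  ...   | _ , q , _ , _ , dq = q , dq

  dist<n : ∀ u → dist u < n
  dist<n u = injective⇒≤ {f = level} level-injective
    where
    level : Fin (suc (dist u)) → Fin n
    level i = proj₁ (dist-below (s≤s⁻¹ (toℕ<n i)))
    level-injective : ∀ {i j} → level i ≡ level j → i ≡ j
    level-injective {i} {j} eq = toℕ-injective (begin
      toℕ i             ≡⟨ sym (proj₂ (dist-below (s≤s⁻¹ (toℕ<n i)))) ⟩
      dist (level i)    ≡⟨ cong dist eq ⟩
      dist (level j)    ≡⟨ proj₂ (dist-below (s≤s⁻¹ (toℕ<n j))) ⟩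
      toℕ j             ∎)
      where open ≡-Reasoning

Resolves : ∀ {n} → Graph n → ℕ → Fin n → Set
Resolves {n} G k r =
  ∀ (u v : Fin n) → (∀ d e → IsDist G u r d → IsDist G v r e → d ⊓ suc k ≡ e ⊓ suc k) → u ≡ v

TruncMetricDim≡1⇔resolving-vertex : ∀ {n} (G : Graph n) k → TruncMetricDim G k 1 ⇔ ∃ (Resolves G k)
TruncMetricDim≡1⇔resolving-vertex G k = mk⇔ to from
  where
  to : TruncMetricDim G k 1 → ∃ (Resolves G k)
  to ((R , ((r , r∈R) , resolving) , ∣R∣≡1) , _) = r , λ u v same →
    resolving u v λ s s∈R → subst (λ s → ∀ d e → IsDist G u s d → IsDist G v s e → _)
                                  (sym (∣p∣≡1⇒∈-unique r∈R ∣R∣≡1 s∈R)) same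
  from : ∃ (Resolves G k) → TruncMetricDim G k 1
  from (r , resolves) =
    (⁅ r ⁆ , ((r , x∈⁅x⁆ r) , λ u v same → resolves u v (same r (x∈⁅x⁆ r))) , ∣⁅x⁆∣≡1 r) ,
    λ _ (((_ , x∈R) , _)) → x∈p⇒1≤∣p∣ x∈R

module ResolvedBy {n} (G : Graph n) (adj? : ∀ u v → Dec (Adj G u v)) (conn : Connected G)
                  {k} {r} (resolves : Resolves G k r) where

  open Geodesics G adj? conn r public

  dist-resolves : ∀ {u v} → dist u ⊓ suc k ≡ dist v ⊓ suc k → u ≡ v
  dist-resolves {u} {v} eq = resolves u v λ d e du dv →
    subst₂ (λ d e → d ⊓ suc k ≡ e ⊓ suc k) (sym (IsDist⇒≡dist du)) (sym (IsDist⇒≡dist dv)) eq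

  dist-injective : ∀ {u v} → dist u ≡ dist v → u ≡ v
  dist-injective eq = dist-resolves (cong (_⊓ suc k) eq)

  dist≤1+k : ∀ u → dist u ≤ suc k
  dist≤1+k u with dist u ≤? suc k
  ... | yes du≤1+k = du≤1+k
  ... | no du≰1+k with dist-below (<⇒≤ (≰⇒> du≰1+k))
  ...   | w , dw≡1+k = contradiction (≤-reflexive (trans (cong dist u≡w) dw≡1+k)) du≰1+k
    where
    u≡w : u ≡ w
    u≡w = dist-resolves (trans (m≥n⇒m⊓n≡n (<⇒≤ (≰⇒> du≰1+k)))
                               (sym (trans (m≤n⇒m⊓n≡m (≤-reflexive dw≡1+k)) dw≡1+k)))

  n≤k+2 : n ≤ k + 2
  n≤k+2 = subst (n ≤_) (+-comm 2 k)
    (injective-bounded⇒≤ dist (λ u → s≤s (dist≤1+k u)) dist-injective)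

  dist-onto : ∀ {ℓ} → ℓ < n → ∃[ u ] (dist u ≡ ℓ)
  dist-onto {ℓ} ℓ<n with any? (λ u → ℓ ≤? dist u)
  ... | yes (u , ℓ≤du) = dist-below ℓ≤du
  ... | no ∄u          = contradiction (injective-bounded⇒≤ dist dist<ℓ dist-injective) (<⇒≱ ℓ<n)
    where
    dist<ℓ : ∀ u → dist u < ℓ
    dist<ℓ u = ≰⇒> λ ℓ≤du → ∄u (u , ℓ≤du)

  -- Each level holds a single vertex, so the descent found by walk-descends is the step b → a.
  walk-traverses-descending-edge : ∀ {a b m} (w : Walk G b r m) → suc (dist a) ≡ dist b →
                                   Traverses w b a
  walk-traverses-descending-edge {a} {b} w 1+da≡db
    with walk-descends w {dist a} (≤-reflexive 1+da≡db) dist-r≤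
  ... | p , q , t , dp≡1+da , dq≡da =
    subst₂ (Traverses w) (dist-injective (trans dp≡1+da 1+da≡db)) (dist-injective dq≡da) t

  adjacent⇒consecutive : ∀ {u v} → Adj G u v → Consecutive (dist u) (dist v)
  adjacent⇒consecutive {u} {v} e with <-cmp (dist u) (dist v)
  ... | tri< du<dv _ _ = inj₁ (≤-antisym du<dv (dist-adj-≤ (symm G e)))
  ... | tri≈ _ du≡dv _ = contradiction (subst (Adj G u) (sym (dist-injective du≡dv)) e) (irrefl G)
  ... | tri> _ _ dv<du = inj₂ (≤-antisym dv<du (dist-adj-≤ e))

  consecutive⇒adjacent : ∀ {u v} → Consecutive (dist u) (dist v) → Adj G u v
  consecutive⇒adjacent {u} {v} (inj₁ 1+du≡dv) with dist-descent (sym 1+du≡dv)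
  ... | w , e , dw≡du = symm G (subst (Adj G v) (dist-injective dw≡du) e)
  consecutive⇒adjacent {u} {v} (inj₂ 1+dv≡du) with dist-descent (sym 1+dv≡du)
  ... | w , e , dw≡dv = subst (Adj G u) (dist-injective dw≡dv) e

  ≅PathGraph : G ≅ PathGraph n
  ≅PathGraph = mk⤖ {to = position} (position-injective , strictlySurjective⇒surjective onto) ,
               λ u v → mk⇔ (λ e → subst₂ Consecutive (sym (position-dist u)) (sym (position-dist v))
                                                     (adjacent⇒consecutive e))
                           (λ c → consecutive⇒adjacent
                                    (subst₂ Consecutive (position-dist u) (position-dist v) c))
    where
    position : Fin n → Fin n
    position u = fromℕ< (dist<n u)
    position-dist : ∀ u → toℕ (position u) ≡ dist u
    position-dist u = toℕ-fromℕ< (dist<n u)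
    position-injective : ∀ {u v} → position u ≡ position v → u ≡ v
    position-injective {u} {v} eq =
      dist-injective (trans (sym (position-dist u)) (trans (cong toℕ eq) (position-dist v)))
    onto : ∀ i → ∃[ u ] (position u ≡ i)
    onto i with dist-onto (toℕ<n i)
    ... | u , du≡i = u , toℕ-injective (trans (position-dist u) du≡i)

module _ {n} (G : Graph n) (conn : Connected G) where

  private
    W : ∀ x y → Walk G x y (proj₁ (conn x y))
    W x y = proj₂ (conn x y)

  Traversed : Fin n → Fin n → Set
  Traversed a b = ∃₂ λ x y → Traverses (W x y) a b ⊎ Traverses (W x y) b a

  traversed? : ∀ a b → Dec (Traversed a b)
  traversed? a b = any? λ x → any? λ y → traverses? (W x y) a b ⊎-dec traverses? (W x y) b a

  traversed⇒Adj : ∀ {a b} → Traversed a b → Adj G a b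
  traversed⇒Adj (x , y , inj₁ t) = traverses⇒Adj (W x y) t
  traversed⇒Adj (x , y , inj₂ t) = symm G (traverses⇒Adj (W x y) t)

  resolved-Adj⇒traversed : (∀ u v → Dec (Adj G u v)) → ∀ {k r} → Resolves G k r →
                           ∀ {a b} → Adj G a b → Traversed a b
  resolved-Adj⇒traversed adj? {r = r} resolves {a} {b} e =
    [ (λ 1+da≡db → b , r , inj₂ (walk-traverses-descending-edge (W b r) 1+da≡db))
    , (λ 1+db≡da → a , r , inj₁ (walk-traverses-descending-edge (W a r) 1+db≡da)) ]′
    (adjacent⇒consecutive e)
    where open ResolvedBy G adj? conn resolves

  resolved⇒Adj? : ∀ {k r} → Resolves G k r → ∀ a b → Dec (Adj G a b)
  resolved⇒Adj? resolves a b = map′ traversed⇒Adj Adj⇒traversed (traversed? a b)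
    where
    Adj⇒traversed : Adj G a b → Traversed a b
    Adj⇒traversed e = decidable-stable (traversed? a b) λ ¬t →
      ¬¬-Adj? λ adj? → ¬t (resolved-Adj⇒traversed adj? resolves e)
      where
      open RawMonad ¬¬-Monad using (rawApplicative)
      ¬¬-Adj? : ¬ ¬ (∀ u v → Dec (Adj G u v))
      ¬¬-Adj? = sequence rawApplicative λ u → sequence rawApplicative λ v → ¬¬-excluded-middle

resolving-vertex⇒path : ∀ {n k r} {G : Graph n} → Connected G → Resolves G k r →
                        n ≤ k + 2 × G ≅ PathGraph n
resolving-vertex⇒path {G = G} conn resolves = n≤k+2 , ≅PathGraph
  where open ResolvedBy G (resolved⇒Adj? G conn resolves) conn resolves

module DistanceCertificate {n} (G : Graph n) (r : Fin n) (h : Fin n → ℕ)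
  (h-r : h r ≡ 0) (h≡0⇒≡r : ∀ {u} → h u ≡ 0 → u ≡ r)
  (h-adj-≤ : ∀ {u v} → Adj G u v → h u ≤ suc (h v))
  (h-descent : ∀ {u ℓ} → h u ≡ suc ℓ → ∃[ w ] (Adj G u w × h w ≡ ℓ)) where

  walk-from-h : ∀ {u ℓ} → h u ≡ ℓ → Walk G u r ℓ
  walk-from-h {u} {zero} hu≡0 = subst (λ x → Walk G x r 0) (sym (h≡0⇒≡r hu≡0)) here
  walk-from-h {u} {suc ℓ} hu≡1+ℓ with h-descent hu≡1+ℓ
  ... | w , e , hw≡ℓ = step e (walk-from-h hw≡ℓ)

  walk-length-≥ : ∀ {x y m} → Walk G x y m → h x ≤ m + h y
  walk-length-≥ here = ≤-refl
  walk-length-≥ (step e rest) = ≤-trans (h-adj-≤ e) (s≤s (walk-length-≥ rest))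

  h-isDist : ∀ u → IsDist G u r (h u)
  h-isDist u = walk-from-h refl , λ m walk →
    ≤-trans (walk-length-≥ walk) (≤-reflexive (trans (cong (m +_) h-r) (+-identityʳ m)))

path⇒resolving-vertex : ∀ {n m k} {G : Graph n} → 0 < n → m ≤ k + 2 → G ≅ PathGraph m →
                        ∃ (Resolves G k)
path⇒resolving-vertex {suc _} {zero} _ _ (f , _) with Bijection.to f zero
... | ()
path⇒resolving-vertex {suc _} {suc m′} {k} {G} _ m≤k+2 (f , preserves) = r , resolves
  where
  open Bijection f using (to; injective)
  open Surjection (Bijection.surjection f) using (to⁻; to∘to⁻)
  r : Fin _
  r = to⁻ zero
  position : Fin _ → ℕ
  position u = toℕ (to u)
  position≤1+k : ∀ u → position u ≤ suc k
  position≤1+k u = s≤s⁻¹ (≤-trans (toℕ<n (to u)) (subst (suc m′ ≤_) (+-comm k 2) m≤k+2))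
  descent : ∀ {u ℓ} → position u ≡ suc ℓ → ∃[ w ] (Adj G u w × position w ≡ ℓ)
  descent {u} {ℓ} pu≡1+ℓ =
    w , Equivalence.from (preserves u w) (inj₂ (trans (cong suc pw≡ℓ) (sym pu≡1+ℓ))) , pw≡ℓ
    where
    ℓ<m : ℓ < suc m′
    ℓ<m = subst (_≤ suc m′) pu≡1+ℓ (<⇒≤ (toℕ<n (to u)))
    w : Fin _
    w = to⁻ (fromℕ< ℓ<m)
    pw≡ℓ : position w ≡ ℓ
    pw≡ℓ = trans (cong toℕ (to∘to⁻ (fromℕ< ℓ<m))) (toℕ-fromℕ< ℓ<m)
  open DistanceCertificate G r position (cong toℕ (to∘to⁻ zero))
    (λ pu≡0 → injective (trans (toℕ-injective pu≡0) (sym (to∘to⁻ zero))))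
    (λ {u} {v} e → Consecutive⇒≤1+ (Equivalence.to (preserves u v) e))
    descent
  resolves : Resolves G k r
  resolves u v same = injective (toℕ-injective (begin
    position u           ≡⟨ sym (m≤n⇒m⊓n≡m (position≤1+k u)) ⟩
    position u ⊓ suc k   ≡⟨ same _ _ (h-isDist u) (h-isDist v) ⟩
    position v ⊓ suc k   ≡⟨ m≤n⇒m⊓n≡m (position≤1+k v) ⟩
    position v           ∎))
    where open ≡-Reasoning

corollary1 : (k n : ℕ) → 0 Data.Nat.< k → 0 Data.Nat.< n →
    (G : Graph n) → Connected G →
    TruncMetricDim G k 1 ⇔ (∃[ m ] (m ≤ k + 2 × G ≅ PathGraph m))
corollary1 k n _ 0<n G conn = mk⇔
  (λ β≡1 → let r , resolves = Equivalence.to β≡1⇔ β≡1 in n , resolving-vertex⇒path conn resolves)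
  (λ (m , m≤k+2 , G≅Pm) → Equivalence.from β≡1⇔ (path⇒resolving-vertex 0<n m≤k+2 G≅Pm))
  where
  β≡1⇔ : TruncMetricDim G k 1 ⇔ ∃ (Resolves G k)
  β≡1⇔ = TruncMetricDim≡1⇔resolving-vertex G k
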